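{- Let $\ell\ge2$ and let $\lambda$ be an $\ell$-core. Then the $n$-vector of $\lambda$ equals $\pi^{ -1}(\lambda)$.
   Context: Partitions are in English notation; box $(x,y)$ is in row $x$, column $y$, with residue the least nonnegative integer $\equiv y-x\pmod\ell$. An $\ell$-core is a partition no hook length of which is divisible by $\ell$. The $n$-vector of an $\ell$-core $\lambda$: pad $\lambda$ with infinitely many zero parts and adjoin a column $0$ (boxes $(x,0)$, $x\ge1$), labeling all boxes by residues. Region $r$ is the set of boxes $(x,y)$ with $(r-1)\ell\le y-x<r\ell$. A box is row-exposed if it is the last box of its row (including the column-$0$ box of a zero row). Then $b_i$ is the maximum $r$ such that region $r$ contains a row-exposed box of residue $i$, and the $n$-vector is $(b_0,\ldots,b_{\ell-1})$. For $\mathbf{c}=(c_0,\ldots,c_{\ell-1})\in\mathbf{Z}^\ell$ with $\sum c_j=0$, let $X(\mathbf{c})=\{r\ell+j:0\le j\le\ell-1,\ r\le c_j\}$ (balanced flush abacus: runner $j$ filled with beads down to level $c_j$) and $\pi(\mathbf{c})$ the partition whose parts are the nonzero values of $|\{y\notin X(\mathbf{c}):y<x\}|$, $x\in X(\mathbf{c})$; $\pi$ is a bijection from such vectors onto the $\ell$-cores. -}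

module Defs where

open import Data.Nat as ℕ using (ℕ; zero; suc; NonZero)
open import Data.Integer as ℤ using (ℤ; +_; _/ℕ_; _%ℕ_; ∣_∣)
open import Data.Bool using (Bool; true; false; not; if_then_else_)
open import Data.Fin using (Fin; toℕ; fromℕ<)
open import Data.List using (List; []; _∷_; length; filterᵇ; upTo; downFrom; lookup)
open import Data.Product using (Σ; _×_; _,_; ∃)
open import Relation.Binary.PropositionalEquality using (_≡_)
open import Relation.Nullary using (¬_)
open import Data.Nat.Divisibility using (_∣_)
open import Data.Integer.DivMod using (n%ℕd<d)
open import Data.List using (map)

data Decreasing : List ℕ → Set where
  []  : Decreasing []
  [-] : ∀ {a} → Decreasing (a ∷ [])
  _∷_ : ∀ {a b l} → b ℕ.≤ a → Decreasing (b ∷ l) → Decreasing (a ∷ b ∷ l)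

data AllPos : List ℕ → Set where
  []  : AllPos []
  _∷_ : ∀ {a l} → 1 ℕ.≤ a → AllPos l → AllPos (a ∷ l)

IsPartition : List ℕ → Set
IsPartition λ′ = Decreasing λ′ × AllPos λ′

part : List ℕ → ℕ → ℕ
part []       _             = 0
part (a ∷ l)  zero          = 0      -- row 0 does not exist; never used
part (a ∷ l)  (suc zero)    = a
part (a ∷ l)  (suc (suc x)) = part l (suc x)

conj : List ℕ → ℕ → ℕ
conj λ′ y = length (filterᵇ (λ a → y ℕ.≤ᵇ a) λ′)

hook : List ℕ → ℕ → ℕ → ℕ
hook λ′ x y = (part λ′ x ℕ.∸ y) ℕ.+ (conj λ′ y ℕ.∸ x) ℕ.+ 1

IsCore : ℕ → List ℕ → Set
IsCore ℓ λ′ = IsPartition λ′ ×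
  (∀ x y → 1 ℕ.≤ x → 1 ℕ.≤ y → y ℕ.≤ part λ′ x → ¬ (ℓ ∣ hook λ′ x y))

content : ℕ → ℕ → ℤ
content x y = + y ℤ.- + x

residue : (ℓ : ℕ) .{{_ : NonZero ℓ}} → ℕ → ℕ → ℕ
residue ℓ x y = content x y %ℕ ℓ

InRegion : ℕ → ℤ → ℕ → ℕ → Set
InRegion ℓ r x y = ((r ℤ.- ℤ.1ℤ) ℤ.* + ℓ ℤ.≤ content x y) × (content x y ℤ.< r ℤ.* + ℓ)

-- box (x,y) (x ≥ 1, y ≥ 0, column 0 adjoined) is row-exposed:
-- it is the last box of row x, i.e. y = λ_x (y = 0 for a zero row)
RowExposed : List ℕ → ℕ → ℕ → Set
RowExposed λ′ x y = (1 ℕ.≤ x) × (y ≡ part λ′ x)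

IsNVector : (ℓ : ℕ) .{{_ : NonZero ℓ}} → List ℕ → (Fin ℓ → ℤ) → Set
IsNVector ℓ λ′ b = ∀ (i : Fin ℓ) →
    (∃ λ x → ∃ λ y → RowExposed λ′ x y × residue ℓ x y ≡ toℕ i × InRegion ℓ (b i) x y)
  × (∀ (r : ℤ) x y → RowExposed λ′ x y → residue ℓ x y ≡ toℕ i → InRegion ℓ r x y → r ℤ.≤ b i)

sumℤ : ∀ {n} → (Fin n → ℤ) → ℤ
sumℤ {zero}  c = ℤ.0ℤ
sumℤ {suc n} c = c Fin.zero ℤ.+ sumℤ (λ i → c (Fin.suc i))
  where import Data.Fin as Fin

sumAbs : ∀ {n} → (Fin n → ℤ) → ℕ
sumAbs {zero}  c = 0
sumAbs {suc n} c = ∣ c Fin.zero ∣ ℕ.+ sumAbs (λ i → c (Fin.suc i))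
  where import Data.Fin as Fin

-- membership in X(c) = {rℓ + j : 0 ≤ j < ℓ, r ≤ c_j}:
-- y = rℓ + j with r = ⌊y/ℓ⌋, j = y mod ℓ, so y ∈ X(c) iff ⌊y/ℓ⌋ ≤ c_{y mod ℓ}
inX : (ℓ : ℕ) .{{_ : NonZero ℓ}} → (Fin ℓ → ℤ) → ℤ → Bool
inX ℓ c y = (y /ℕ ℓ) ℤ.≤ᵇ c (fromℕ< (n%ℕd<d y ℓ))

-- π(c): parts are the nonzero values of g(x) = #{y ∉ X(c) : y < x}, x ∈ X(c),
-- listed in decreasing order of x (which gives weakly decreasing parts).
-- With B = Σ|c_j|, every y < lo = -ℓ(B+1) lies in X(c) and no y ≥ ℓ(B+1)
-- lies in X(c); so all gaps lie in the window [lo, lo+N), N = 2ℓ(B+1),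
-- elements of X(c) below lo have g = 0, and for x = lo + k in the window
-- g(x) = #{k' < k : lo + k' ∉ X(c)}.
π : (ℓ : ℕ) .{{_ : NonZero ℓ}} → (Fin ℓ → ℤ) → List ℕ
π ℓ c = filterᵇ (λ p → 1 ℕ.≤ᵇ p) (map gaps (filterᵇ (λ k → inX ℓ c (pos k)) (downFrom N)))
  where
  B : ℕ
  B = sumAbs c
  lo : ℤ
  lo = ℤ.- (+ (ℓ ℕ.* suc B))
  N : ℕ
  N = 2 ℕ.* (ℓ ℕ.* suc B)
  pos : ℕ → ℤ
  pos k = lo ℤ.+ + k
  gaps : ℕ → ℕ
  gaps k = length (filterᵇ (λ k′ → not (inX ℓ c (pos k′))) (upTo k))

-- In the window of 2ℓβ positions used by π (β = 1 + Σ|c_j|), which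
-- contains every gap of X(c), the rows of λ correspond to the beads taken in decreasing order, and the
-- row of the bead at position w ends in a box of content w − ℓ; this needs the window to hold exactly
-- ℓ(β + 1) beads, which is where Σ c_j = 0 enters. Hence the row-exposed boxes of residue i come from
-- the beads on runner i, a bead at level r giving a box in region r, while all other rows are empty and
-- end in regions below −β ≤ c_i. The top bead of runner i sits at level c_i, so b_i = c_i.

module Submission where

open import Defs
open import Data.Nat using (ℕ; zero; suc; NonZero; _≤_; _<_; _+_; _*_; _∸_; _≤ᵇ_; _≤?_; z≤n; s≤s; s≤s⁻¹)
open import Data.Nat.Properties
import Data.Nat.Tactic.RingSolver as ℕ-Solver
open import Data.Integer as ℤ using (ℤ; +_; -[1+_]; 0ℤ; 1ℤ; _/ℕ_; _%ℕ_; ∣_∣)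
import Data.Integer.Properties as ℤP
open import Data.Integer.DivMod using (a≡a%ℕn+[a/ℕn]*n; n%ℕd<d)
open import Data.Integer.Tactic.RingSolver using (solve-∀)
open import Algebra.Bundles using (AbelianGroup)
open import Algebra.Properties.Group (AbelianGroup.group ℤP.+-0-abelianGroup) using (∙-cancelʳ)
open import Data.Fin using (Fin; toℕ; fromℕ<)
import Data.Fin as Fin
open import Data.Fin.Properties using (toℕ<n; fromℕ<-cong; fromℕ<-toℕ)
open import Data.Bool using (Bool; true; false; not; T)
open import Data.Bool.Properties using (T-≡)
open import Data.List using (List; []; _∷_; length; filterᵇ; upTo; downFrom; map; applyUpTo)
open import Data.List.Properties using (length-map)
open import Data.List.Relation.Unary.All as All using (All; []; _∷_)
open import Data.Product using (_×_; _,_; ∃-syntax; proj₁; proj₂)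
open import Data.Sum using (inj₁; inj₂)
open import Data.Empty using (⊥-elim)
open import Function using (_∘_)
open import Function.Bundles using (Equivalence)
open import Relation.Binary.PropositionalEquality
open import Relation.Nullary using (¬_; yes; no)
open import Relation.Nullary.Reflects using (fromEquivalence; det)

iverson : Bool → ℕ
iverson true  = 1
iverson false = 0

iverson-T : ∀ {b} → T b → iverson b ≡ 1
iverson-T {true} _ = refl

iverson-¬T : ∀ {b} → ¬ T b → iverson b ≡ 0
iverson-¬T {false} _  = refl
iverson-¬T {true}  ¬b = ⊥-elim (¬b _)

sum< : (ℕ → ℕ) → ℕ → ℕ
sum< h zero    = 0
sum< h (suc n) = h 0 + sum< (h ∘ suc) n

sum<-snoc : ∀ h n → sum< h (suc n) ≡ sum< h n + h n
sum<-snoc h zero    = +-identityʳ (h 0)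
sum<-snoc h (suc n) = trans (cong (λ s → h 0 + s) (sum<-snoc (h ∘ suc) n)) (sym (+-assoc (h 0) _ _))

sum<-cong : ∀ {h g} n → (∀ i → i < n → h i ≡ g i) → sum< h n ≡ sum< g n
sum<-cong zero    _   = refl
sum<-cong (suc n) h≡g = cong₂ _+_ (h≡g 0 (s≤s z≤n)) (sum<-cong n (λ i i<n → h≡g (suc i) (s≤s i<n)))

sum<-const : ∀ a n → sum< (λ _ → a) n ≡ n * a
sum<-const a zero    = refl
sum<-const a (suc n) = cong (λ s → a + s) (sum<-const a n)

sum<-+ : ∀ h g n → sum< (λ i → h i + g i) n ≡ sum< h n + sum< g n
sum<-+ h g zero    = refl
sum<-+ h g (suc n) = trans (cong (λ s → h 0 + g 0 + s) (sum<-+ (h ∘ suc) (g ∘ suc) n))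
                           (interchange (h 0) (g 0) (sum< (h ∘ suc) n) (sum< (g ∘ suc) n))
  where
  interchange : ∀ a b c d → a + b + (c + d) ≡ a + c + (b + d)
  interchange = ℕ-Solver.solve-∀

sum<-++ : ∀ h m n → sum< h (m + n) ≡ sum< h m + sum< (λ i → h (m + i)) n
sum<-++ h zero    n = refl
sum<-++ h (suc m) n = trans (cong (λ s → h 0 + s) (sum<-++ (h ∘ suc) m n)) (sym (+-assoc (h 0) _ _))

sum<-columns : ∀ h q L → sum< h (q * L) ≡ sum< (λ j → sum< (λ q′ → h (q′ * L + j)) q) L
sum<-columns h zero    L = sym (trans (sum<-const 0 L) (*-zeroʳ L))
sum<-columns h (suc q) L = begin
  sum< h (L + q * L)                                               ≡⟨ sum<-++ h L (q * L) ⟩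
  sum< h L + sum< (λ i → h (L + i)) (q * L)
    ≡⟨ cong (λ s → sum< h L + s) (sum<-columns (λ i → h (L + i)) q L) ⟩
  sum< h L + sum< (λ j → sum< (λ q′ → h (L + (q′ * L + j))) q) L   ≡⟨ sum<-+ h _ L ⟨
  sum< (λ j → h j + sum< (λ q′ → h (L + (q′ * L + j))) q) L
    ≡⟨ sum<-cong L (λ j _ → cong (λ s → h j + s)
                                 (sum<-cong q (λ q′ _ → cong h (sym (+-assoc L (q′ * L) j))))) ⟩
  sum< (λ j → sum< (λ q′ → h (q′ * L + j)) (suc q)) L              ∎
  where open ≡-Reasoning

length-filterᵇ-applyUpTo : ∀ (g : ℕ → Bool) f k →
  length (filterᵇ g (applyUpTo f k)) ≡ sum< (λ i → iverson (g (f i))) k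
length-filterᵇ-applyUpTo g f zero = refl
length-filterᵇ-applyUpTo g f (suc k) with g (f 0)
... | true  = cong suc (length-filterᵇ-applyUpTo g (f ∘ suc) k)
... | false = length-filterᵇ-applyUpTo g (f ∘ suc) k

count-≤ᵇ : ∀ {t n} → t < n → sum< (λ q → iverson (q ≤ᵇ t)) n ≡ suc t
count-≤ᵇ {t} {n} t<n = begin
  sum< f n                                           ≡⟨ cong (sum< f) (sym (m+[n∸m]≡n t<n)) ⟩
  sum< f (suc t + (n ∸ suc t))                       ≡⟨ sum<-++ f (suc t) (n ∸ suc t) ⟩
  sum< f (suc t) + sum< (λ i → f (suc t + i)) (n ∸ suc t)
    ≡⟨ cong₂ _+_ (sum<-cong (suc t) (λ q q≤t → iverson-T (≤⇒≤ᵇ (s≤s⁻¹ q≤t))))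
                 (sum<-cong (n ∸ suc t) (λ i _ → iverson-¬T (<⇒≱ (m≤m+n (suc t) i) ∘ ≤ᵇ⇒≤ _ t))) ⟩
  sum< (λ _ → 1) (suc t) + sum< (λ _ → 0) (n ∸ suc t)
    ≡⟨ cong₂ _+_ (sum<-const 1 (suc t)) (sum<-const 0 (n ∸ suc t)) ⟩
  suc t * 1 + (n ∸ suc t) * 0
    ≡⟨ cong₂ _+_ (*-identityʳ (suc t)) (*-zeroʳ (n ∸ suc t)) ⟩
  suc t + 0                                           ≡⟨ +-identityʳ (suc t) ⟩
  suc t                                               ∎
  where
  open ≡-Reasoning
  f : ℕ → ℕ
  f q = iverson (q ≤ᵇ t)

part-beyond-length : ∀ (l : List ℕ) x → length l < x → part l x ≡ 0
part-beyond-length []      x             _         = refl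
part-beyond-length (a ∷ l) (suc zero)    (s≤s ())
part-beyond-length (a ∷ l) (suc (suc x)) (s≤s len<) = part-beyond-length l (suc x) len<

Decreasing-tail : ∀ {a l} → Decreasing (a ∷ l) → Decreasing l
Decreasing-tail [-]     = []
Decreasing-tail (_ ∷ d) = d

All≤⇒Decreasing-∷ : ∀ {a l} → All (_≤ a) l → Decreasing l → Decreasing (a ∷ l)
All≤⇒Decreasing-∷ []          _ = [-]
All≤⇒Decreasing-∷ (b≤a ∷ _) d = b≤a ∷ d

part-zero-headed : ∀ {l} → Decreasing (0 ∷ l) → ∀ x → part (0 ∷ l) x ≡ 0
part-zero-headed         _         zero          = refl
part-zero-headed         _         (suc zero)    = refl
part-zero-headed {[]}    _         (suc (suc x)) = refl
part-zero-headed {_ ∷ l} (z≤n ∷ d) (suc (suc x)) = part-zero-headed d (suc x)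

filter-zero-headed : ∀ {l} → Decreasing (0 ∷ l) → filterᵇ (1 ≤ᵇ_) l ≡ []
filter-zero-headed {[]}    _         = refl
filter-zero-headed {_ ∷ l} (z≤n ∷ d) = filter-zero-headed d

part-filter-positive : ∀ {l} → Decreasing l → ∀ x → part (filterᵇ (1 ≤ᵇ_) l) x ≡ part l x
part-filter-positive {[]}        _ _             = refl
part-filter-positive {zero ∷ l}  d x rewrite filter-zero-headed d = sym (part-zero-headed d x)
part-filter-positive {suc a ∷ l} d zero          = refl
part-filter-positive {suc a ∷ l} d (suc zero)    = refl
part-filter-positive {suc a ∷ l} d (suc (suc x)) = part-filter-positive (Decreasing-tail d) (suc x)

module BeadSequence (p : ℕ → Bool) where

  gaps : ℕ → ℕ
  gaps k = length (filterᵇ (not ∘ p) (upTo k))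

  beads : ℕ → List ℕ
  beads n = filterᵇ p (downFrom n)

  rows : ℕ → List ℕ
  rows n = map gaps (beads n)

  beadCount : ℕ → ℕ
  beadCount n = length (beads n)

  beads-accept : ∀ n → p n ≡ true → beads (suc n) ≡ n ∷ beads n
  beads-accept n pn rewrite pn = refl

  beadCount-suc : ∀ n → beadCount (suc n) ≡ iverson (p n) + beadCount n
  beadCount-suc n with p n
  ... | true  = refl
  ... | false = refl

  beadCount≡sum : ∀ n → beadCount n ≡ sum< (iverson ∘ p) n
  beadCount≡sum zero    = refl
  beadCount≡sum (suc n) = begin
    beadCount (suc n)                       ≡⟨ beadCount-suc n ⟩
    iverson (p n) + beadCount n             ≡⟨ +-comm (iverson (p n)) _ ⟩
    beadCount n + iverson (p n)             ≡⟨ cong (_+ iverson (p n)) (beadCount≡sum n) ⟩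
    sum< (iverson ∘ p) n + iverson (p n)    ≡⟨ sum<-snoc (iverson ∘ p) n ⟨
    sum< (iverson ∘ p) (suc n)              ∎
    where open ≡-Reasoning

  gaps≡sum : ∀ k → gaps k ≡ sum< (iverson ∘ not ∘ p) k
  gaps≡sum = length-filterᵇ-applyUpTo (not ∘ p) (λ i → i)

  gaps+beadCount : ∀ k → gaps k + beadCount k ≡ k
  gaps+beadCount k = begin
    gaps k + beadCount k                                ≡⟨ cong₂ _+_ (gaps≡sum k) (beadCount≡sum k) ⟩
    sum< (iverson ∘ not ∘ p) k + sum< (iverson ∘ p) k   ≡⟨ sum<-+ (iverson ∘ not ∘ p) (iverson ∘ p) k ⟨
    sum< (λ i → iverson (not (p i)) + iverson (p i)) k ≡⟨ sum<-cong k (λ i _ → complement (p i)) ⟩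
    sum< (λ _ → 1) k                                    ≡⟨ sum<-const 1 k ⟩
    k * 1                                               ≡⟨ *-identityʳ k ⟩
    k                                                   ∎
    where
    open ≡-Reasoning
    complement : ∀ b → iverson (not b) + iverson b ≡ 1
    complement true  = refl
    complement false = refl

  gaps-mono : ∀ k → gaps k ≤ gaps (suc k)
  gaps-mono k = subst (gaps k ≤_) (sym gaps-suc) (m≤m+n (gaps k) _)
    where
    gaps-suc : gaps (suc k) ≡ gaps k + iverson (not (p k))
    gaps-suc = trans (gaps≡sum (suc k))
                     (trans (sum<-snoc _ k) (cong (_+ iverson (not (p k))) (sym (gaps≡sum k))))

  rows-bounded : ∀ n → All (_≤ gaps n) (rows n)
  rows-bounded zero    = []
  rows-bounded (suc n) with p n
  ... | false = All.map (λ a≤ → ≤-trans a≤ (gaps-mono n)) (rows-bounded n)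
  ... | true  = gaps-mono n ∷ All.map (λ a≤ → ≤-trans a≤ (gaps-mono n)) (rows-bounded n)

  rows-decreasing : ∀ n → Decreasing (rows n)
  rows-decreasing zero    = []
  rows-decreasing (suc n) with p n
  ... | false = rows-decreasing n
  ... | true  = All≤⇒Decreasing-∷ (rows-bounded n) (rows-decreasing n)

  length-rows : ∀ n → length (rows n) ≡ beadCount n
  length-rows n = length-map gaps (beads n)

  top-row : ∀ n → gaps n + suc (beadCount n) ≡ n + 1
  top-row n = trans (+-suc (gaps n) _) (trans (cong suc (gaps+beadCount n)) (+-comm 1 n))

  +-suc-both : ∀ {a m k x} → a + m ≡ k + x → a + suc m ≡ k + suc x
  +-suc-both {a} {m} {k} {x} eq = trans (+-suc a m) (trans (cong suc eq) (sym (+-suc k x)))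

  -- The x-th largest bead k < n has beadCount n ∸ x beads below it, so its row has length
  -- gaps k = k + x ∸ beadCount n.
  row⇒bead : ∀ n x → 1 ≤ x → x ≤ beadCount n →
             ∃[ k ] k < n × p k ≡ true × part (rows n) x + beadCount n ≡ k + x
  row⇒bead zero    x 1≤x x≤0 = ⊥-elim (<⇒≱ 1≤x x≤0)
  row⇒bead (suc n) x 1≤x x≤ with p n in pn
  ... | false with row⇒bead n x 1≤x x≤
  ...   | k , k<n , pk , eq = k , m≤n⇒m≤1+n k<n , pk , eq
  row⇒bead (suc n) (suc zero) _ _ | true = n , ≤-refl , pn , top-row n
  row⇒bead (suc n) (suc (suc x)) _ x≤ | true with row⇒bead n (suc x) (s≤s z≤n) (s≤s⁻¹ x≤)
  ...   | k , k<n , pk , eq = k , m≤n⇒m≤1+n k<n , pk , +-suc-both eq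

  bead⇒row : ∀ n k → k < n → p k ≡ true →
             ∃[ x ] 1 ≤ x × part (rows n) x + beadCount n ≡ k + x
  bead⇒row (suc n) k k<1+n pk with m≤n⇒m<n∨m≡n (s≤s⁻¹ k<1+n)
  ... | inj₂ refl rewrite beads-accept k pk = 1 , s≤s z≤n , top-row k
  ... | inj₁ k<n with p n | bead⇒row n k k<n pk
  ...   | false | row             = row
  ...   | true  | suc x , _ , eq = suc (suc x) , s≤s z≤n , +-suc-both eq

module _ (d : ℕ) .{{_ : NonZero d}} where

  quotient-≤ : ∀ {r r′} q q′ → r′ < d → + r ℤ.+ q ℤ.* + d ≡ + r′ ℤ.+ q′ ℤ.* + d → q ℤ.≤ q′
  quotient-≤ {r} {r′} q q′ r′<d eq =
    subst (q ℤ.≤_) (ℤP.pred-suc q′)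
          (ℤP.i<j⇒i≤pred[j] {q} {ℤ.suc q′} (ℤP.*-cancelʳ-<-nonNeg (+ d) q*d<[1+q′]*d))
    where
    open ℤP.≤-Reasoning
    distrib : ∀ a b → a ℤ.+ b ℤ.* a ≡ (1ℤ ℤ.+ b) ℤ.* a
    distrib = solve-∀
    q*d<[1+q′]*d : q ℤ.* + d ℤ.< ℤ.suc q′ ℤ.* + d
    q*d<[1+q′]*d = begin-strict
      q ℤ.* + d                ≤⟨ ℤP.i≤j+i (q ℤ.* + d) (+ r) ⟩
      + r ℤ.+ q ℤ.* + d        ≡⟨ eq ⟩
      + r′ ℤ.+ q′ ℤ.* + d      <⟨ ℤP.+-monoˡ-< (q′ ℤ.* + d) (ℤ.+<+ r′<d) ⟩
      + d ℤ.+ q′ ℤ.* + d       ≡⟨ distrib (+ d) q′ ⟩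
      ℤ.suc q′ ℤ.* + d         ∎

  [r+q*d]/ℕd≡q : ∀ {r} q → r < d → (+ r ℤ.+ q ℤ.* + d) /ℕ d ≡ q
  [r+q*d]/ℕd≡q {r} q r<d =
    ℤP.≤-antisym (quotient-≤ (a /ℕ d) q r<d (sym split)) (quotient-≤ q (a /ℕ d) (n%ℕd<d a d) split)
    where
    a = + r ℤ.+ q ℤ.* + d
    split : a ≡ + (a %ℕ d) ℤ.+ (a /ℕ d) ℤ.* + d
    split = a≡a%ℕn+[a/ℕn]*n a d

  [r+q*d]%ℕd≡r : ∀ {r} q → r < d → (+ r ℤ.+ q ℤ.* + d) %ℕ d ≡ r
  [r+q*d]%ℕd≡r {r} q r<d = ℤP.+-injective (∙-cancelʳ (q ℤ.* + d) _ _ (begin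
    + (a %ℕ d) ℤ.+ q ℤ.* + d          ≡⟨ cong (λ q′ → + (a %ℕ d) ℤ.+ q′ ℤ.* + d) ([r+q*d]/ℕd≡q q r<d) ⟨
    + (a %ℕ d) ℤ.+ (a /ℕ d) ℤ.* + d   ≡⟨ a≡a%ℕn+[a/ℕn]*n a d ⟨
    + r ℤ.+ q ℤ.* + d                  ∎))
    where
    open ≡-Reasoning
    a = + r ℤ.+ q ℤ.* + d

region-≤ : ∀ ℓ {r} Q x y → InRegion ℓ r x y → content x y ℤ.< Q ℤ.* + ℓ → r ℤ.≤ Q
region-≤ ℓ {r} Q x y (lower , _) upper =
  subst (ℤ._≤ Q) (1+[r-1]≡r r)
        (ℤP.i<j⇒suc[i]≤j {r ℤ.- 1ℤ} (ℤP.*-cancelʳ-<-nonNeg (+ ℓ) (ℤP.≤-<-trans lower upper)))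
  where
  1+[r-1]≡r : ∀ r → 1ℤ ℤ.+ (r ℤ.- 1ℤ) ≡ r
  1+[r-1]≡r = solve-∀

module _ (ℓ : ℕ) .{{_ : NonZero ℓ}} where

  digits⇒residue-region : ∀ x y {j} Q → j < ℓ → content x y ≡ (+ j ℤ.+ Q ℤ.* + ℓ) ℤ.- + ℓ →
                          residue ℓ x y ≡ j × InRegion ℓ Q x y
  digits⇒residue-region x y {j} Q j<ℓ content≡ =
    trans (cong (_%ℕ ℓ) eq) ([r+q*d]%ℕd≡r ℓ (Q ℤ.- 1ℤ) j<ℓ) ,
    subst ((Q ℤ.- 1ℤ) ℤ.* + ℓ ℤ.≤_) (sym eq) (ℤP.i≤j+i _ (+ j)) ,
    subst₂ ℤ._<_ (sym eq) (top Q (+ ℓ)) (ℤP.+-monoˡ-< ((Q ℤ.- 1ℤ) ℤ.* + ℓ) (ℤ.+<+ j<ℓ))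
    where
    shift-level : ∀ j Q L → (j ℤ.+ Q ℤ.* L) ℤ.- L ≡ j ℤ.+ (Q ℤ.- 1ℤ) ℤ.* L
    shift-level = solve-∀
    top : ∀ Q L → L ℤ.+ (Q ℤ.- 1ℤ) ℤ.* L ≡ Q ℤ.* L
    top = solve-∀
    eq : content x y ≡ + j ℤ.+ (Q ℤ.- 1ℤ) ℤ.* + ℓ
    eq = trans content≡ (shift-level (+ j) Q (+ ℓ))

  fromℕ<-%ℕ : ∀ w (i : Fin ℓ) → w %ℕ ℓ ≡ toℕ i → fromℕ< (n%ℕd<d w ℓ) ≡ i
  fromℕ<-%ℕ w i eq = trans (fromℕ<-cong _ _ eq _ (toℕ<n i)) (fromℕ<-toℕ i _)

  inX-digits : ∀ c (i : Fin ℓ) Q → inX ℓ c (+ toℕ i ℤ.+ Q ℤ.* + ℓ) ≡ (Q ℤ.≤ᵇ c i)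
  inX-digits c i Q = cong₂ ℤ._≤ᵇ_ ([r+q*d]/ℕd≡q ℓ Q (toℕ<n i))
    (cong c (fromℕ<-%ℕ (+ toℕ i ℤ.+ Q ℤ.* + ℓ) i ([r+q*d]%ℕd≡r ℓ Q (toℕ<n i))))

  inX⇒level≤ : ∀ c w (i : Fin ℓ) → inX ℓ c w ≡ true → w %ℕ ℓ ≡ toℕ i → w /ℕ ℓ ℤ.≤ c i
  inX⇒level≤ c w i bead w≡i =
    subst (λ j → w /ℕ ℓ ℤ.≤ c j) (fromℕ<-%ℕ w i w≡i) (ℤP.≤ᵇ⇒≤ (subst T (sym bead) _))

+≡+⇒content≡ : ∀ {a m k x} → a + m ≡ k + x → content x a ≡ + k ℤ.- + m
+≡+⇒content≡ {a} {m} {k} {x} eq = begin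
  + a ℤ.- + x                       ≡⟨ add-m (+ a) (+ m) (+ x) ⟩
  (+ a ℤ.+ + m) ℤ.- + x ℤ.- + m     ≡⟨ cong (λ s → + s ℤ.- + x ℤ.- + m) eq ⟩
  (+ k ℤ.+ + x) ℤ.- + x ℤ.- + m     ≡⟨ cancel-x (+ k) (+ m) (+ x) ⟩
  + k ℤ.- + m                       ∎
  where
  open ≡-Reasoning
  add-m : ∀ a m x → a ℤ.- x ≡ (a ℤ.+ m) ℤ.- x ℤ.- m
  add-m = solve-∀
  cancel-x : ∀ k m x → (k ℤ.+ x) ℤ.- x ℤ.- m ≡ k ℤ.- m
  cancel-x = solve-∀

∣∣≤sumAbs : ∀ {n} (c : Fin n → ℤ) i → ∣ c i ∣ ≤ sumAbs c
∣∣≤sumAbs c Fin.zero    = m≤m+n _ _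
∣∣≤sumAbs c (Fin.suc i) = ≤-trans (∣∣≤sumAbs (c ∘ Fin.suc) i) (m≤n+m _ _)

-[1+B]≤ : ∀ z B → ∣ z ∣ ≤ B → -[1+ B ] ℤ.≤ z
-[1+B]≤ (+ n)    B _     = ℤ.-≤+
-[1+B]≤ -[1+ n ] B 1+n≤B = ℤ.-≤- (≤-trans (n≤1+n n) 1+n≤B)

window-offset : ∀ z B → ∣ z ∣ ≤ B → ∃[ t ] + t ≡ z ℤ.+ + suc B × t < 2 * suc B
window-offset (+ n) B n≤B =
  n + suc B , refl ,
  ≤-trans (+-monoˡ-≤ (suc B) (s≤s n≤B)) (≤-reflexive (cong (λ m → suc B + m) (sym (+-identityʳ (suc B)))))
window-offset -[1+ n ] B 1+n≤B =
  B ∸ n , sym (ℤP.⊖-≥ (m≤n⇒m≤1+n 1+n≤B)) , s≤s (≤-trans (m∸n≤m B n) (m≤m+n B _))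

level-shift : ∀ {z b t} q → + t ≡ z ℤ.+ + b → ((+ q ℤ.- + b) ℤ.≤ᵇ z) ≡ (q ≤ᵇ t)
level-shift {z} {b} {t} q t≡z+b = det (fromEquivalence to from) (≤ᵇ-reflects-≤ q t)
  where
  shift-back : ∀ u b → (u ℤ.- b) ℤ.+ b ≡ u
  shift-back = solve-∀
  to : T ((+ q ℤ.- + b) ℤ.≤ᵇ z) → q ≤ t
  to h = ℤP.drop‿+≤+ (subst₂ ℤ._≤_ (shift-back (+ q) (+ b)) (sym t≡z+b)
                                   (ℤP.+-monoˡ-≤ (+ b) (ℤP.≤ᵇ⇒≤ {+ q ℤ.- + b} {z} h)))
  from : q ≤ t → T ((+ q ℤ.- + b) ℤ.≤ᵇ z)
  from q≤t = ℤP.≤⇒≤ᵇ (subst ((+ q ℤ.- + b) ℤ.≤_) (cancel z (+ b))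
    (ℤP.+-monoˡ-≤ (ℤ.- + b) (subst (+ q ℤ.≤_) t≡z+b (ℤ.+≤+ q≤t))))
    where
    cancel : ∀ z b → (z ℤ.+ b) ℤ.- b ≡ z
    cancel = solve-∀

sum<-toℤ : ∀ n (h : ℕ → ℕ) (g : Fin n → ℤ) → (∀ i → + h (toℕ i) ≡ g i) → + sum< h n ≡ sumℤ g
sum<-toℤ zero    h g _   = refl
sum<-toℤ (suc n) h g h≡g =
  cong₂ ℤ._+_ (h≡g Fin.zero) (sum<-toℤ n (h ∘ suc) (g ∘ Fin.suc) (h≡g ∘ Fin.suc))

sumℤ-+-const : ∀ {n} (c : Fin n → ℤ) K → sumℤ (λ i → c i ℤ.+ + K) ≡ sumℤ c ℤ.+ + (n * K)
sumℤ-+-const {zero}  c K = refl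
sumℤ-+-const {suc n} c K = begin
  (c Fin.zero ℤ.+ + K) ℤ.+ sumℤ (λ i → c (Fin.suc i) ℤ.+ + K)
    ≡⟨ cong (λ s → (c Fin.zero ℤ.+ + K) ℤ.+ s) (sumℤ-+-const (c ∘ Fin.suc) K) ⟩
  (c Fin.zero ℤ.+ + K) ℤ.+ (sumℤ (c ∘ Fin.suc) ℤ.+ + (n * K))
    ≡⟨ interchange (c Fin.zero) (+ K) (sumℤ (c ∘ Fin.suc)) (+ (n * K)) ⟩
  (c Fin.zero ℤ.+ sumℤ (c ∘ Fin.suc)) ℤ.+ (+ K ℤ.+ + (n * K))
    ∎
  where
  open ≡-Reasoning
  interchange : ∀ a b s m → (a ℤ.+ b) ℤ.+ (s ℤ.+ m) ≡ (a ℤ.+ s) ℤ.+ (b ℤ.+ m)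
  interchange = solve-∀

module BalancedAbacus (ℓ : ℕ) .{{_ : NonZero ℓ}} (c : Fin ℓ → ℤ) (balanced : sumℤ c ≡ 0ℤ) where

  β : ℕ
  β = suc (sumAbs c)

  lo : ℤ
  lo = ℤ.- + (ℓ * β)

  N : ℕ
  N = 2 * (ℓ * β)

  N≡columns : N ≡ 2 * β * ℓ
  N≡columns = reorder ℓ β
    where
    reorder : ∀ l b → 2 * (l * b) ≡ 2 * b * l
    reorder = ℕ-Solver.solve-∀

  bead : ℕ → Bool
  bead k = inX ℓ c (lo ℤ.+ + k)

  open BeadSequence bead

  window-digits : ∀ q j → lo ℤ.+ + (q * ℓ + j) ≡ + j ℤ.+ (+ q ℤ.- + β) ℤ.* + ℓ
  window-digits q j = begin
    ℤ.- + (ℓ * β) ℤ.+ + (q * ℓ + j)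
      ≡⟨ cong₂ (λ a b → ℤ.- a ℤ.+ b) (ℤP.pos-* ℓ β)
               (trans (ℤP.pos-+ (q * ℓ) j) (cong (ℤ._+ + j) (ℤP.pos-* q ℓ))) ⟩
    ℤ.- (+ ℓ ℤ.* + β) ℤ.+ (+ q ℤ.* + ℓ ℤ.+ + j)
      ≡⟨ regroup (+ ℓ) (+ β) (+ q) (+ j) ⟩
    + j ℤ.+ (+ q ℤ.- + β) ℤ.* + ℓ
      ∎
    where
    open ≡-Reasoning
    regroup : ∀ L b q j → ℤ.- (L ℤ.* b) ℤ.+ (q ℤ.* L ℤ.+ j) ≡ j ℤ.+ (q ℤ.- b) ℤ.* L
    regroup = solve-∀

  bead-column : ∀ q (i : Fin ℓ) → bead (q * ℓ + toℕ i) ≡ ((+ q ℤ.- + β) ℤ.≤ᵇ c i)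
  bead-column q i = trans (cong (inX ℓ c) (window-digits q (toℕ i))) (inX-digits ℓ c i (+ q ℤ.- + β))

  column-count : ∀ (i : Fin ℓ) → + sum< (λ q → iverson (bead (q * ℓ + toℕ i))) (2 * β) ≡ c i ℤ.+ + suc β
  column-count i with window-offset (c i) (sumAbs c) (∣∣≤sumAbs c i)
  ... | t , t≡ , t<2β = begin
    + sum< (λ q → iverson (bead (q * ℓ + toℕ i))) (2 * β)
      ≡⟨ cong +_ (sum<-cong (2 * β) λ q _ →
                   cong iverson (trans (bead-column q i) (level-shift {c i} {β} q t≡))) ⟩
    + sum< (λ q → iverson (q ≤ᵇ t)) (2 * β)  ≡⟨ cong +_ (count-≤ᵇ t<2β) ⟩
    1ℤ ℤ.+ + t                                ≡⟨ cong (λ z → 1ℤ ℤ.+ z) t≡ ⟩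
    1ℤ ℤ.+ (c i ℤ.+ + β)                      ≡⟨ regroup (c i) (+ β) ⟩
    c i ℤ.+ (1ℤ ℤ.+ + β)                      ∎
    where
    open ≡-Reasoning
    regroup : ∀ a b → 1ℤ ℤ.+ (a ℤ.+ b) ≡ a ℤ.+ (1ℤ ℤ.+ b)
    regroup = solve-∀

  beadCount-window : beadCount N ≡ ℓ * suc β
  beadCount-window = ℤP.+-injective (begin
    + beadCount N                                  ≡⟨ cong +_ (beadCount≡sum N) ⟩
    + sum< (iverson ∘ bead) N                      ≡⟨ cong (λ n → + sum< (iverson ∘ bead) n) N≡columns ⟩
    + sum< (iverson ∘ bead) (2 * β * ℓ)            ≡⟨ cong +_ (sum<-columns (iverson ∘ bead) (2 * β) ℓ) ⟩
    + sum< (λ j → sum< (λ q → iverson (bead (q * ℓ + j))) (2 * β)) ℓ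
                                                   ≡⟨ sum<-toℤ ℓ _ (λ i → c i ℤ.+ + suc β) column-count ⟩
    sumℤ (λ i → c i ℤ.+ + suc β)                   ≡⟨ sumℤ-+-const c (suc β) ⟩
    sumℤ c ℤ.+ + (ℓ * suc β)                       ≡⟨ cong (ℤ._+ + (ℓ * suc β)) balanced ⟩
    + (ℓ * suc β)                                  ∎)
    where
    open ≡-Reasoning

  row-end-content : ∀ x k → part (rows N) x + beadCount N ≡ k + x →
                    content x (part (π ℓ c) x) ≡ (lo ℤ.+ + k) ℤ.- + ℓ
  row-end-content x k eq = begin
    content x (part (π ℓ c) x)            ≡⟨ cong (content x) (part-filter-positive (rows-decreasing N) x) ⟩
    content x (part (rows N) x)           ≡⟨ +≡+⇒content≡ {part (rows N) x} {beadCount N} {k} {x} eq ⟩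
    + k ℤ.- + beadCount N                 ≡⟨ cong (λ m → + k ℤ.- + m) beadCount-window ⟩
    + k ℤ.- + (ℓ * suc β)                 ≡⟨ cong (λ m → + k ℤ.- m) (ℤP.pos-* ℓ (suc β)) ⟩
    + k ℤ.- + ℓ ℤ.* + suc β               ≡⟨ regroup (+ k) (+ ℓ) (+ β) ⟩
    (ℤ.- (+ ℓ ℤ.* + β) ℤ.+ + k) ℤ.- + ℓ  ≡⟨ cong (λ m → (ℤ.- m ℤ.+ + k) ℤ.- + ℓ) (ℤP.pos-* ℓ β) ⟨
    (lo ℤ.+ + k) ℤ.- + ℓ                  ∎
    where
    open ≡-Reasoning
    regroup : ∀ k L b → k ℤ.- L ℤ.* (1ℤ ℤ.+ b) ≡ (ℤ.- (L ℤ.* b) ℤ.+ k) ℤ.- L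
    regroup = solve-∀

  top-bead : ∀ (i : Fin ℓ) → ∃[ k ] k < N × bead k ≡ true × lo ℤ.+ + k ≡ + toℕ i ℤ.+ c i ℤ.* + ℓ
  top-bead i with window-offset (c i) (sumAbs c) (∣∣≤sumAbs c i)
  ... | t , t≡ , t<2β = t * ℓ + toℕ i , k<N , is-bead , k≡
    where
    cancel : ∀ z b → (z ℤ.+ b) ℤ.- b ≡ z
    cancel = solve-∀
    k≡ : lo ℤ.+ + (t * ℓ + toℕ i) ≡ + toℕ i ℤ.+ c i ℤ.* + ℓ
    k≡ = trans (window-digits t (toℕ i))
               (cong (λ q → + toℕ i ℤ.+ q ℤ.* + ℓ) (trans (cong (ℤ._- + β) t≡) (cancel (c i) (+ β))))
    is-bead : bead (t * ℓ + toℕ i) ≡ true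
    is-bead = trans (cong (inX ℓ c) k≡)
                    (trans (inX-digits ℓ c i (c i)) (Equivalence.to T-≡ (ℤP.≤⇒≤ᵇ (ℤP.≤-refl {c i}))))
    k<N : t * ℓ + toℕ i < N
    k<N = begin-strict
      t * ℓ + toℕ i  <⟨ +-monoʳ-< (t * ℓ) (toℕ<n i) ⟩
      t * ℓ + ℓ      ≡⟨ +-comm (t * ℓ) ℓ ⟩
      suc t * ℓ      ≤⟨ *-monoˡ-≤ ℓ t<2β ⟩
      2 * β * ℓ      ≡⟨ N≡columns ⟨
      N              ∎
      where open ≤-Reasoning

  existence : ∀ (i : Fin ℓ) →
    ∃[ x ] ∃[ y ] RowExposed (π ℓ c) x y × residue ℓ x y ≡ toℕ i × InRegion ℓ (c i) x y
  existence i with top-bead i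
  ... | k , k<N , is-bead , k≡ with bead⇒row N k k<N is-bead
  ...   | x , 1≤x , eq = x , part (π ℓ c) x , (1≤x , refl) ,
          digits⇒residue-region ℓ x _ (c i) (toℕ<n i) (trans (row-end-content x k eq) (cong (ℤ._- + ℓ) k≡))

  maximal : ∀ (i : Fin ℓ) r x y → RowExposed (π ℓ c) x y → residue ℓ x y ≡ toℕ i →
            InRegion ℓ r x y → r ℤ.≤ c i
  maximal i r x _ (1≤x , refl) res in-r with x ≤? beadCount N
  ... | yes x≤ with row⇒bead N x 1≤x x≤
  ...   | k , _ , is-bead , eq = ℤP.≤-trans (region-≤ ℓ Q x _ in-r (proj₂ (proj₂ digits))) Q≤c
    where
    w = lo ℤ.+ + k
    Q = w /ℕ ℓ
    digits : residue ℓ x (part (π ℓ c) x) ≡ w %ℕ ℓ × InRegion ℓ Q x (part (π ℓ c) x)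
    digits = digits⇒residue-region ℓ x _ Q (n%ℕd<d w ℓ)
               (trans (row-end-content x k eq) (cong (ℤ._- + ℓ) (a≡a%ℕn+[a/ℕn]*n w ℓ)))
    Q≤c : Q ℤ.≤ c i
    Q≤c = inX⇒level≤ ℓ c w i is-bead (trans (sym (proj₁ digits)) res)
  maximal i r x _ (1≤x , refl) res in-r | no x≰ =
    ℤP.≤-trans (region-≤ ℓ (ℤ.- + β) x _ in-r below-window) (-[1+B]≤ (c i) (sumAbs c) (∣∣≤sumAbs c i))
    where
    empty-row : part (π ℓ c) x ≡ 0
    empty-row = trans (part-filter-positive (rows-decreasing N) x)
                      (part-beyond-length (rows N) x (subst (_< x) (sym (length-rows N)) (≰⇒> x≰)))
    β*ℓ<x : β * ℓ < x
    β*ℓ<x = begin-strict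
      β * ℓ          ≡⟨ *-comm β ℓ ⟩
      ℓ * β          ≤⟨ *-monoʳ-≤ ℓ (n≤1+n β) ⟩
      ℓ * suc β      ≡⟨ beadCount-window ⟨
      beadCount N    <⟨ ≰⇒> x≰ ⟩
      x              ∎
      where open ≤-Reasoning
    neg-* : ∀ b L → ℤ.- (b ℤ.* L) ≡ ℤ.- b ℤ.* L
    neg-* = solve-∀
    below-window : content x (part (π ℓ c) x) ℤ.< ℤ.- + β ℤ.* + ℓ
    below-window = begin-strict
      content x (part (π ℓ c) x)   ≡⟨ cong (content x) empty-row ⟩
      0ℤ ℤ.- + x                   ≡⟨ ℤP.+-identityˡ (ℤ.- + x) ⟩
      ℤ.- + x                      <⟨ ℤP.neg-mono-< (ℤ.+<+ β*ℓ<x) ⟩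
      ℤ.- + (β * ℓ)                ≡⟨ cong ℤ.-_ (ℤP.pos-* β ℓ) ⟩
      ℤ.- (+ β ℤ.* + ℓ)            ≡⟨ neg-* (+ β) (+ ℓ) ⟩
      ℤ.- + β ℤ.* + ℓ              ∎
      where open ℤP.≤-Reasoning

  n-vector : IsNVector ℓ (π ℓ c) c
  n-vector i = existence i , λ r x y → maximal i r x y

corollary3p13 : (ℓ : ℕ) .{{_ : NonZero ℓ}} → 2 ≤ ℓ →
    (λ′ : List ℕ) → IsCore ℓ λ′ →
    (c : Fin ℓ → ℤ) → sumℤ c ≡ 0ℤ → π ℓ c ≡ λ′ →
    IsNVector ℓ λ′ c
corollary3p13 ℓ _ ._ _ c balanced refl = BalancedAbacus.n-vector ℓ c balanced
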